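{- Let $G$ be a finite bipartite graph with bipartition $U,W$, and let $S$ and $T$ be maximal stable sets of $G$. Then $(U\cap S\cap T)\cup (W\setminus N(S\cap T))$ is a maximal stable set of $G$.
   Context: A set of vertices is stable if no two of its vertices are adjacent; a stable set is maximal if it is maximal under inclusion. For a set $S$ of vertices, $N(S)$ denotes the set of vertices adjacent to some vertex of $S$. -}

module Defs where

open import Data.Nat using (ℕ)
open import Data.Fin using (Fin)
open import Data.Product using (_×_; ∃-syntax)
open import Data.Sum using (_⊎_)
open import Data.Empty using (⊥)
open import Relation.Nullary using (¬_)
open import Relation.Unary using (Pred; _⊆_; _∩_; _∪_; _∈_; _∉_)
open import Relation.Binary.PropositionalEquality using (_≡_)

record Graph (n : ℕ) : Set₁ where
  field
    Adj    : Fin n → Fin n → Set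
    sym    : ∀ {x y} → Adj x y → Adj y x
    irrefl : ∀ {x} → ¬ Adj x x

open Graph public

VSet : ℕ → Set₁
VSet n = Pred (Fin n) _

record IsBipartition {n : ℕ} (G : Graph n) (U W : VSet n) : Set where
  field
    cover    : ∀ x → x ∈ U ⊎ x ∈ W
    disjoint : ∀ x → x ∈ U → x ∈ W → ⊥
    edgesUW  : ∀ {x y} → Adj G x y → (x ∈ U × y ∈ W) ⊎ (x ∈ W × y ∈ U)

Stable : ∀ {n} → Graph n → VSet n → Set
Stable G S = ∀ {x y} → x ∈ S → y ∈ S → ¬ Adj G x y

MaximalStable : ∀ {n} → Graph n → VSet n → Set₁
MaximalStable {n} G S = Stable G S × (∀ (S' : VSet n) → Stable G S' → S ⊆ S' → S' ⊆ S)

N : ∀ {n} → Graph n → VSet n → VSet n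
N G S x = ∃[ y ] (y ∈ S × Adj G y x)

_∖_ : ∀ {n} → VSet n → VSet n → VSet n
(A ∖ B) x = x ∈ A × x ∉ B

-- A stable set S is maximal iff every vertex without a neighbour in S lies in S.
-- Let R = (U ∩ S ∩ T) ∪ (W ∖ N(S ∩ T)) and let x have no neighbour in R.
-- If x ∈ W, a neighbour of x in S ∩ T would lie in U, hence in R; so x ∈ R.
-- If x ∈ U, every neighbour y of x in S lies in W and, S being stable, outside
-- N(S ∩ T); so y ∈ R, which is impossible. Hence x ∈ S by maximality of S,
-- likewise x ∈ T, and x ∈ R.
module Submission where

open import Defs
open import Data.Nat using (ℕ)
open import Data.Fin using (Fin)
open import Data.Product using (_,_; proj₁; proj₂)
open import Data.Sum using (_⊎_; inj₁; inj₂)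
open import Data.Empty using (⊥-elim)
open import Function using (_∘_)
open import Relation.Nullary using (¬_)
open import Relation.Unary using (_∩_; _∪_; _∈_; _∉_; _⊆_)
open import Relation.Binary.PropositionalEquality using (_≡_; refl)

module StableSets {n : ℕ} (G : Graph n) where

  Stable-⊆ : ∀ {A B : VSet n} → Stable G B → A ⊆ B → Stable G A
  Stable-⊆ stB A⊆B x∈A y∈A = stB (A⊆B x∈A) (A⊆B y∈A)

  Stable-∪ : ∀ {A B : VSet n} → Stable G A → Stable G B →
    (∀ {x y} → x ∈ A → y ∈ B → ¬ Adj G x y) → Stable G (A ∪ B)
  Stable-∪ stA stB cross (inj₁ x∈A) (inj₁ y∈A) = stA x∈A y∈A
  Stable-∪ stA stB cross (inj₁ x∈A) (inj₂ y∈B) = cross x∈A y∈B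
  Stable-∪ stA stB cross (inj₂ x∈B) (inj₁ y∈A) = cross y∈A x∈B ∘ sym G
  Stable-∪ stA stB cross (inj₂ x∈B) (inj₂ y∈B) = stB x∈B y∈B

  Stable⇒∉N : ∀ {A S : VSet n} {x : Fin n} → Stable G S → A ⊆ S → x ∈ S → x ∉ N G A
  Stable⇒∉N stS A⊆S x∈S (y , y∈A , y~x) = stS (A⊆S y∈A) x∈S y~x

  maximalStable⇒closed : ∀ {S : VSet n} {x : Fin n} → MaximalStable G S → x ∉ N G S → x ∈ S
  maximalStable⇒closed {S} {x} (stS , maxS) x∉NS = maxS S+x stS+x inj₁ (inj₂ refl)
    where
    S+x : VSet n
    S+x v = v ∈ S ⊎ v ≡ x

    stS+x : Stable G S+x
    stS+x (inj₁ u∈S) (inj₁ v∈S) = stS u∈S v∈S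
    stS+x (inj₁ u∈S) (inj₂ refl) u~x = x∉NS (_ , u∈S , u~x)
    stS+x (inj₂ refl) (inj₁ v∈S) x~v = x∉NS (_ , v∈S , sym G x~v)
    stS+x (inj₂ refl) (inj₂ refl) = irrefl G

  closed⇒maximalStable : ∀ {S : VSet n} → Stable G S →
    (∀ {x} → x ∉ N G S → x ∈ S) → MaximalStable G S
  closed⇒maximalStable stS closed =
    stS , λ S' stS' S⊆S' x∈S' → closed (Stable⇒∉N stS' S⊆S' x∈S')

module Bipartite {n : ℕ} {G : Graph n} {U W : VSet n} (bp : IsBipartition G U W) where
  open IsBipartition bp

  Adj-W⇒U : ∀ {x y} → Adj G x y → y ∈ W → x ∈ U
  Adj-W⇒U {x} {y} x~y y∈W with edgesUW x~y
  ... | inj₁ (x∈U , _) = x∈U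
  ... | inj₂ (_ , y∈U) = ⊥-elim (disjoint y y∈U y∈W)

  Adj-U⇒W : ∀ {x y} → Adj G x y → y ∈ U → x ∈ W
  Adj-U⇒W {x} {y} x~y y∈U with edgesUW x~y
  ... | inj₁ (_ , y∈W) = ⊥-elim (disjoint y y∈U y∈W)
  ... | inj₂ (x∈W , _) = x∈W

  Stable-W : Stable G W
  Stable-W {x} x∈W y∈W x~y = disjoint x (Adj-W⇒U x~y y∈W) x∈W

lemma4 : ∀ {n : ℕ} (G : Graph n) (U W S T : VSet n) →
    IsBipartition G U W →
    MaximalStable G S → MaximalStable G T →
    MaximalStable G ((U ∩ S ∩ T) ∪ (W ∖ N G (S ∩ T)))
lemma4 {n} G U W S T bp mS mT = closed⇒maximalStable stable closed
  where
  open IsBipartition bp using (cover)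
  open StableSets G
  open Bipartite bp

  R : VSet n
  R = (U ∩ S ∩ T) ∪ (W ∖ N G (S ∩ T))

  stable : Stable G R
  stable = Stable-∪ (Stable-⊆ (proj₁ mS) λ (_ , x∈S , _) → x∈S) (Stable-⊆ Stable-W proj₁)
                    (λ x∈U∩S∩T (_ , y∉N) x~y → y∉N (_ , proj₂ x∈U∩S∩T , x~y))

  closed : ∀ {x} → x ∉ N G R → x ∈ R
  closed {x} x∉NR with cover x
  ... | inj₂ x∈W = inj₂ (x∈W , λ (y , y∈S∩T , y~x) →
                           x∉NR (y , inj₁ (Adj-W⇒U y~x x∈W , y∈S∩T) , y~x))
  ... | inj₁ x∈U = inj₁ (x∈U , closed-U mS proj₁ , closed-U mT proj₂)
    where
    closed-U : ∀ {V} → MaximalStable G V → S ∩ T ⊆ V → x ∈ V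
    closed-U mV S∩T⊆V = maximalStable⇒closed mV λ (y , y∈V , y~x) →
      x∉NR (y , inj₂ (Adj-U⇒W y~x x∈U , Stable⇒∉N (proj₁ mV) S∩T⊆V y∈V) , y~x)
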